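{- Let $\tau\in\mathrm{SPCT}((2^n))$ and denote by $\tau_{(i,j)}$ the entry in row $i$ and column $j$. Then: (1) for $1\le i<j\le n$, if $\tau_{(i,1)}>\tau_{(j,1)}$ then $\tau_{(i,2)}>\tau_{(j,2)}$; (2) for $1\le i<j<k\le n$, if $\tau_{(i,1)}<\tau_{(j,1)}<\tau_{(k,1)}$, then it is not the case that $\tau_{(i,2)}>\tau_{(k,2)}>\tau_{(j,2)}$.
   Context: $\mathrm{SPCT}((2^n))$ is the set of fillings $\tau$ of the $n\times2$ array ($n$ rows of length 2, rows indexed $1,\dots,n$ from top) with the distinct integers $1,\dots,2n$ such that each row decreases from left to right and (triple condition) whenever $i<r$ and the entries in cells $(i,1),(i,2),(r,2)$ are $a,b,c$, $a\ge c$ implies $b>c$. -}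

module Defs where

open import Data.Nat using (ℕ; _≤_; _<_; _>_; _≥_; _*_)
open import Data.Fin using (Fin; zero; suc)
open import Data.Product using (_×_)
open import Relation.Binary.PropositionalEquality using (_≡_)

-- A filling of the n × 2 array: row i (Fin n, row 1 = zero at top),
-- column j (Fin 2; zero = column 1, suc zero = column 2).
Filling : ℕ → Set
Filling n = Fin n → Fin 2 → ℕ

col1 col2 : Fin 2
col1 = zero
col2 = suc zero

-- entries are the distinct integers 1,…,2n (injective with values in [1,2n];
-- since there are 2n cells this means each of 1..2n is used exactly once)
DistinctEntries : ∀ n → Filling n → Set
DistinctEntries n τ =
  (∀ i j i' j' → τ i j ≡ τ i' j' → (i ≡ i') × (j ≡ j'))
  × (∀ i j → 1 ≤ τ i j × τ i j ≤ 2 * n)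

RowsDecreasing : ∀ n → Filling n → Set
RowsDecreasing n τ = ∀ i → τ i col1 > τ i col2

TripleCondition : ∀ n → Filling n → Set
TripleCondition n τ = ∀ (i r : Fin n) → i Data.Fin.< r →
  τ i col1 ≥ τ r col2 → τ i col2 > τ r col2

IsSPCT : ∀ n → Filling n → Set
IsSPCT n τ = DistinctEntries n τ × RowsDecreasing n τ × TripleCondition n τ

-- Both parts only use that rows decrease and the triple condition.  In (1),
-- τ(j,2) < τ(j,1) < τ(i,1), so the triple condition for rows i < j applies.
-- In (2), τ(k,2) < τ(i,2) < τ(i,1) < τ(j,1), so the triple condition for
-- rows j < k forces τ(j,2) > τ(k,2), contradicting τ(k,2) > τ(j,2).
module Submission where

open import Defs
open import Data.Nat using (ℕ; _<_; _>_)
open import Data.Fin using (Fin)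
open import Data.Product using (_×_; _,_)
open import Relation.Nullary using (¬_)
open import Data.Nat.Properties using (<-trans; <⇒≤; <-asym)

module _ (n : ℕ) (τ : Filling n)
         (rowsDecreasing : RowsDecreasing n τ) (triple : TripleCondition n τ) where

  col1-descent⇒col2-descent : (i j : Fin n) → i Data.Fin.< j →
    τ i col1 > τ j col1 → τ i col2 > τ j col2
  col1-descent⇒col2-descent i j i<j τj1<τi1 =
    triple i j i<j (<⇒≤ (<-trans (rowsDecreasing j) τj1<τi1))

  no-col2-pattern-under-col1-ascent : (i j k : Fin n) →
    i Data.Fin.< j → j Data.Fin.< k →
    τ i col1 < τ j col1 → τ j col1 < τ k col1 →
    ¬ (τ i col2 > τ k col2 × τ k col2 > τ j col2)
  no-col2-pattern-under-col1-ascent i j k i<j j<k τi1<τj1 _ (τk2<τi2 , τj2<τk2) =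
    <-asym τj2<τk2 (triple j k j<k (<⇒≤ τk2<τj1))
    where
    τk2<τj1 : τ k col2 < τ j col1
    τk2<τj1 = <-trans τk2<τi2 (<-trans (rowsDecreasing i) τi1<τj1)

lemma5p2 : (n : ℕ) (τ : Filling n) → IsSPCT n τ →
    ((i j : Fin n) → i Data.Fin.< j →
    τ i col1 > τ j col1 → τ i col2 > τ j col2)
    × ((i j k : Fin n) → i Data.Fin.< j → j Data.Fin.< k →
    τ i col1 < τ j col1 → τ j col1 < τ k col1 →
    ¬ (τ i col2 > τ k col2 × τ k col2 > τ j col2))
lemma5p2 n τ (_ , rowsDecreasing , triple) =
    col1-descent⇒col2-descent n τ rowsDecreasing triple
  , no-col2-pattern-under-col1-ascent n τ rowsDecreasing triple
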